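{- Let $S=\{n_1,n_2,\ldots,n_s\}$ be a set of integers with $2\le n_s<\cdots<n_2<n_1$. Then the mixed hypergraph $\mathcal H^{\star}_{n_1,\ldots,n_s}=(X_{n_1,\ldots,n_s},\mathcal C^{\star}_{n_1,\ldots,n_s},\mathcal D_{n_1,\ldots,n_s})$, which has $2n_1-2n_s$ $\mathcal C$-edges, is a one-realization of $S$.
   Context: A mixed hypergraph is a triple $\mathcal H=(X,\mathcal C,\mathcal D)$ where $X$ is a finite set and $\mathcal C,\mathcal D$ are families of subsets of $X$ ($\mathcal C$-edges and $\mathcal D$-edges). A proper $k$-coloring is a map from $X$ to a set of $k$ colors such that every $\mathcal C$-edge contains two vertices of a common color and every $\mathcal D$-edge contains two vertices of distinct colors; it is strict if all $k$ colors are used. Colorings are identified with partitions of $X$ into color classes. The feasible set is the set of $k$ for which a strict $k$-coloring exists; $r_k$ is the number of partitions arising as strict $k$-colorings. $\mathcal H$ is a one-realization of $S$ if its feasible set is $S$ and $r_k=1$ for all $k\in S$. Notation: $[m]=\{1,\ldots,m\}$. Vertices are $s$-tuples of integers. For $t\in\{2,\ldots,s\}$ and an integer $j$, let $u_t(j)=(j,\ldots,j,n_t,n_{t+1},\ldots,n_s)$ and $v_t(j)=(j,\ldots,j,1,\ldots,1)$, where in both $j$ is repeated $t-1$ times. Define $X_{n_1,\ldots,n_s}=\{(n_1,\ldots,n_s)\}\cup\{(i,\ldots,i): i\in[n_s-1]\}\cup\{u_t(j),v_t(j): 2\le t\le s,\ n_t\le j\le n_{t-1}-1\}$; $\mathcal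 D_{n_1,\ldots,n_s}$ = all pairs $\{(x_1,\ldots,x_s),(y_1,\ldots,y_s)\}$ of elements of $X_{n_1,\ldots,n_s}$ with $x_i\ne y_i$ for every $i\in[s]$; $\mathcal C^{\star}_{n_1,\ldots,n_s}$ consists of, for each $t\in\{2,\ldots,s\}$: the triples $\{u_t(j),v_t(j),v_t(j-1)\}$ for $n_t+1\le j\le n_{t-1}-1$; the triples $\{v_t(j),u_t(j),u_t(j+1)\}$ for $n_t\le j\le n_{t-1}-1$; and the triple $\{u_t(n_t),v_t(n_t),(1,\ldots,1)\}$. (Note $u_t(n_{t-1})$ is the vertex $(n_{t-1},\ldots,n_{t-1},n_t,\ldots,n_s)$ of $X_{n_1,\ldots,n_s}$, which for $t=2$ is $(n_1,\ldots,n_s)$.) -}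

module Defs where

open import Data.Nat using (ℕ; zero; suc; _+_; _*_; _∸_; _≤_; _<_; _<ᵇ_)
open import Data.Bool using (Bool; true; false; if_then_else_)
open import Data.Fin using (Fin; toℕ)
open import Data.List using (List; []; _∷_; _++_; map; concatMap; upTo; length)
open import Data.List.Membership.Propositional using (_∈_)
open import Data.List.Relation.Binary.Subset.Propositional using (_⊆_)
open import Data.Vec using (Vec; tabulate; replicate)
open import Data.Product using (_×_; ∃-syntax; Σ)
open import Relation.Binary.PropositionalEquality using (_≡_; _≢_)
open import Relation.Nullary using (¬_)
open import Function.Bundles using (_⇔_)

-- Generic mixed hypergraphs (X, C, D); edges are finite lists of vertices,
-- read as sets (order / repetitions are irrelevant to all notions below).

record MixedHypergraph (V : Set) : Set where
  field
    X : List V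
    C : List (List V)
    D : List (List V)

module _ {V : Set} (H : MixedHypergraph V) where
  open MixedHypergraph H

  -- col is a strict proper k-coloring with colors {0,…,k-1}
  -- (only its restriction to X matters).
  IsStrictColoring : ℕ → (V → ℕ) → Set
  IsStrictColoring k col =
      (∀ {x} → x ∈ X → col x < k)
    × (∀ i → i < k → ∃[ x ] (x ∈ X × col x ≡ i))
    × (∀ {e} → e ∈ C → ∃[ x ] ∃[ y ] (x ∈ e × y ∈ e × x ≢ y × col x ≡ col y))
    × (∀ {e} → e ∈ D → ∃[ x ] ∃[ y ] (x ∈ e × y ∈ e × col x ≢ col y))

  SamePartition : (V → ℕ) → (V → ℕ) → Set
  SamePartition c c' = ∀ {x y} → x ∈ X → y ∈ X → ((c x ≡ c y) ⇔ (c' x ≡ c' y))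

  Feasible : ℕ → Set
  Feasible k = ∃[ col ] IsStrictColoring k col

  -- feasible set = S, and r_k = 1 for every k ∈ S
  OneRealization : (ℕ → Set) → Set
  OneRealization S =
      (∀ k → Feasible k ⇔ S k)
    × (∀ k → S k → ∀ c c' → IsStrictColoring k c → IsStrictColoring k c' → SamePartition c c')

-- The sequence n is given as n : ℕ → ℕ,
-- of which only n 1, …, n s are used (1-based indices as in the paper).
-- Vertices are s-tuples Vec ℕ s; coordinate (i : Fin s) is position toℕ i + 1.

-- range a b = [a, a+1, …, b]  (empty if b < a)
range : ℕ → ℕ → List ℕ
range a b = map (a +_) (upTo (suc b ∸ a))

module Construction (s : ℕ) (n : ℕ → ℕ) where

  full : Vec ℕ s
  full = tabulate (λ i → n (suc (toℕ i)))

  diag : ℕ → Vec ℕ s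
  diag i = replicate s i

  u : ℕ → ℕ → Vec ℕ s
  u t j = tabulate (λ i → if toℕ i <ᵇ t ∸ 1 then j else n (suc (toℕ i)))

  v : ℕ → ℕ → Vec ℕ s
  v t j = tabulate (λ i → if toℕ i <ᵇ t ∸ 1 then j else 1)

  Xlist : List (Vec ℕ s)
  Xlist = full ∷ (map diag (range 1 (n s ∸ 1))
          ++ concatMap (λ t → concatMap (λ j → u t j ∷ v t j ∷ [])
                                        (range (n t) (n (t ∸ 1) ∸ 1)))
                       (range 2 s))

  Cstar : List (List (Vec ℕ s))
  Cstar = concatMap edgesAt (range 2 s)
    where
    edgesAt : ℕ → List (List (Vec ℕ s))
    edgesAt t =
         map (λ j → u t j ∷ v t j ∷ v t (j ∸ 1) ∷ []) (range (suc (n t)) (n (t ∸ 1) ∸ 1))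
      ++ map (λ j → v t j ∷ u t j ∷ u t (suc j) ∷ []) (range (n t) (n (t ∸ 1) ∸ 1))
      ++ ((u t (n t) ∷ v t (n t) ∷ diag 1 ∷ []) ∷ [])


open Construction public

-- D-edges: all pairs {x,y} of vertices of X with x_i ≠ y_i for every i
-- (listed as [x , y]; both orders appear, which is harmless).
open import Data.Nat using (_≡ᵇ_)
open import Data.Bool using (not; _∧_)
open import Data.Vec using (zipWith; toList)
open import Data.Bool.ListAction using (and)

allDiffᵇ : ∀ {s} → Vec ℕ s → Vec ℕ s → Bool
allDiffᵇ x y = and (toList (zipWith (λ a b → not (a ≡ᵇ b)) x y))

Dstar : (s : ℕ) (n : ℕ → ℕ) → List (List (Vec ℕ s))
Dstar s n = concatMap (λ x → concatMap (λ y → if allDiffᵇ x y then (x ∷ y ∷ []) ∷ [] else [])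
                                         (Xlist s n))
                      (Xlist s n)

Hstar : (s : ℕ) (n : ℕ → ℕ) → MixedHypergraph (Vec ℕ s)
Hstar s n = record { X = Xlist s n ; C = Cstar s n ; D = Dstar s n }

DistinctAsSets : ∀ {V : Set} → List V → List V → Set
DistinctAsSets e e' = ¬ (e ⊆ e' × e' ⊆ e)

module Submission where

-- Colouring each vertex by its i-th coordinate is a strict n_i-colouring: every
-- C-triple has two vertices agreeing in coordinate i, and D-edges join vertices
-- that differ everywhere.  Conversely, fix a strict colouring.  On level t, either
-- u_t(n_t) and v_t(n_t) share a colour, and then the C-triples force u_t(j) ~ v_t(j)
-- for every j, or all v_t(j) get the colour of (1,…,1) and all u_t(j) that of
-- u_t(n_{t-1}) = u_{t-1}(n_{t-1}).  The first alternative propagates from t to t+1,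
-- so some i separates the levels t ≤ i of the second kind from those above it.  Then
-- every vertex shares its colour with a canonical vertex carrying the same i-th
-- coordinate, while D-edges separate canonical vertices with different coordinates:
-- the colouring induces the coordinate-i partition, and k = n_i.  The number of
-- C-edges telescopes to 2(n_1 - n_s).

open import Defs hiding (full; diag; u; v)
open import Data.Bool using (true; false; if_then_else_; T)
open import Data.Empty using (⊥-elim)
open import Data.Fin as Fin using (Fin; toℕ; fromℕ<)
open import Data.Fin.Properties using (toℕ<n; toℕ-fromℕ<; toℕ-injective; injective⇒≤; fromℕ<-injective)
open import Data.List using (List; []; _∷_; _++_; map; concatMap; upTo; length)
open import Data.List.Membership.Propositional using (_∈_; _∉_; find; lose)
open import Data.List.Membership.Propositional.Properties
  using (∈-map⁺; ∈-map⁻; ∈-++⁺ˡ; ∈-++⁺ʳ; ∈-++⁻; ∈-upTo⁺; ∈-upTo⁻; ∈-concatMap⁺; ∈-concatMap⁻)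
open import Data.List.Properties using (length-++; length-map; length-upTo; upTo-∷ʳ; map-++)
open import Data.List.Relation.Unary.All as All using (All)
import Data.List.Relation.Unary.All.Properties as All
open import Data.List.Relation.Unary.AllPairs using (AllPairs)
import Data.List.Relation.Unary.AllPairs.Properties as AllPairs
open import Data.List.Relation.Unary.Any using (here; there)
open import Data.Nat using (ℕ; zero; suc; _+_; _*_; _∸_; _≤_; _<_; z≤n; s≤s; _<ᵇ_; _≡ᵇ_; _≟_; _<?_; _≤?_)
open import Data.Nat.ListAction using (sum)
open import Data.Nat.ListAction.Properties using (sum-++)
open import Data.Nat.Properties
open import Data.Product using (_×_; ∃; ∃-syntax; _,_; proj₁; proj₂)
open import Data.Sum using (_⊎_; inj₁; inj₂)
open import Data.Vec using (Vec; lookup; _∷_; [])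
open import Data.Vec.Properties using (lookup∘tabulate; tabulate-cong; lookup-replicate)
open import Function using (id; _∘_)
open import Function.Bundles using (_⇔_; mk⇔; Equivalence)
import Function.Properties.Equivalence as ⇔
open import Relation.Binary.Definitions using (tri<; tri≈; tri>)
open import Relation.Binary.PropositionalEquality
  using (_≡_; _≢_; ≢-sym; refl; sym; trans; cong; cong₂; subst; module ≡-Reasoning)
open import Relation.Nullary using (¬_; Dec; yes; no)
open import Relation.Nullary.Decidable using (decidable-stable)

m<n∸o⇒o+m<n : ∀ o n {m} → m < n ∸ o → o + m < n
m<n∸o⇒o+m<n zero n m<n = m<n
m<n∸o⇒o+m<n (suc o) (suc n) m<n = s≤s (m<n∸o⇒o+m<n o n m<n)

<⇒≤∸1 : ∀ {m n} → m < n → m ≤ n ∸ 1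
<⇒≤∸1 (s≤s m≤n) = m≤n

≤∸1⇒< : ∀ {m n} → 1 ≤ m → m ≤ n ∸ 1 → m < n
≤∸1⇒< {n = suc n} _ m≤n = s≤s m≤n
≤∸1⇒< {suc m} {zero} _ ()

m∸1<m : ∀ {m} → 1 ≤ m → m ∸ 1 < m
m∸1<m {suc m} _ = ≤-refl

∸1-injective : ∀ {m n} → 1 ≤ m → 1 ≤ n → m ∸ 1 ≡ n ∸ 1 → m ≡ n
∸1-injective {suc m} {suc n} _ _ = cong suc

suc<⇒<∸1 : ∀ {m n} → suc m < n → m < n ∸ 1
suc<⇒<∸1 (s≤s m<n) = m<n

≤suc⇒∸1≤ : ∀ {m n} → n ≤ suc m → n ∸ 1 ≤ m
≤suc⇒∸1≤ {n = zero} _ = z≤n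
≤suc⇒∸1≤ {n = suc n} (s≤s n≤m) = n≤m

if-<ᵇ-then : ∀ {A : Set} {m n} {x y : A} → m < n → (if m <ᵇ n then x else y) ≡ x
if-<ᵇ-then {m = m} {n} m<n with m <ᵇ n | <⇒<ᵇ m<n
... | true | _ = refl

if-<ᵇ-else : ∀ {A : Set} {m n} {x y : A} → n ≤ m → (if m <ᵇ n then x else y) ≡ y
if-<ᵇ-else {m = m} {n} n≤m with m <ᵇ n in eq
... | false = refl
... | true = ⊥-elim (<⇒≱ (<ᵇ⇒< m n (subst T (sym eq) _)) n≤m)

∈-range⁺ : ∀ {a b j} → a ≤ j → j ≤ b → j ∈ range a b
∈-range⁺ {a} {b} a≤j j≤b =
  subst (_∈ range a b) (m+[n∸m]≡n a≤j) (∈-map⁺ (a +_) (∈-upTo⁺ (∸-monoˡ-< (s≤s j≤b) a≤j)))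

∈-range⁻ : ∀ a b {j} → j ∈ range a b → a ≤ j × j ≤ b
∈-range⁻ a b p with ∈-map⁻ (a +_) p
... | q , q∈ , refl = m≤m+n a q , ≤-pred (m<n∸o⇒o+m<n a (suc b) (∈-upTo⁻ q∈))

∈-range-below⁺ : ∀ {a m j} → a ≤ j → j < m → j ∈ range a (m ∸ 1)
∈-range-below⁺ a≤j j<m = ∈-range⁺ a≤j (<⇒≤∸1 j<m)

∈-range-below⁻ : ∀ {a m j} → 1 ≤ a → j ∈ range a (m ∸ 1) → a ≤ j × j < m
∈-range-below⁻ {a} {m} 1≤a j∈ with ∈-range⁻ a (m ∸ 1) j∈
... | a≤j , j≤ = a≤j , ≤∸1⇒< (≤-trans 1≤a a≤j) j≤

length-range : ∀ a b → length (range a b) ≡ suc b ∸ a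
length-range a b = trans (length-map (a +_) (upTo (suc b ∸ a))) (length-upTo (suc b ∸ a))

allPairs-range : ∀ {R : ℕ → ℕ → Set} a b → (∀ {i j} → a ≤ i → i < j → j ≤ b → R i j) → AllPairs R (range a b)
allPairs-range a b R-range = AllPairs.map⁺ (AllPairs.applyUpTo⁺₁ id (suc b ∸ a)
  λ {i} {j} i<j j<k → R-range (m≤m+n a i) (+-monoʳ-< a i<j) (≤-pred (m<n∸o⇒o+m<n a (suc b) j<k)))

module _ {A B : Set} (f : A → List B) where

  length-concatMap : (g : A → ℕ) (xs : List A) → (∀ {x} → x ∈ xs → length (f x) ≡ g x)
                   → length (concatMap f xs) ≡ sum (map g xs)
  length-concatMap g [] _ = refl
  length-concatMap g (x ∷ xs) length-f≡g =
    trans (length-++ (f x))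
          (cong₂ _+_ (length-f≡g (here refl)) (length-concatMap g xs (length-f≡g ∘ there)))

  ∈-concatMap-intro : ∀ {xs x y} → x ∈ xs → y ∈ f x → y ∈ concatMap f xs
  ∈-concatMap-intro x∈ y∈ = ∈-concatMap⁺ f (lose x∈ y∈)

  ∈-concatMap-elim : ∀ xs {y} → y ∈ concatMap f xs → ∃ λ x → x ∈ xs × y ∈ f x
  ∈-concatMap-elim xs y∈ = find (∈-concatMap⁻ f y∈)

telescope : (f g : ℕ → ℕ) (m : ℕ) → (∀ t → 2 ≤ t → t ≤ suc m → g t + f t ≡ f (t ∸ 1))
          → sum (map g (range 2 (suc m))) + f (suc m) ≡ f 1
telescope f g zero step = refl
telescope f g (suc m) step = begin
    sum (map g (map (2 +_) (upTo (suc m)))) + f (2 + m)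
  ≡⟨ cong (λ ts → sum (map g ts) + f (2 + m)) (trans (cong (map (2 +_)) (sym (upTo-∷ʳ m))) (map-++ (2 +_) (upTo m) (m ∷ []))) ⟩
    sum (map g (map (2 +_) (upTo m) ++ (2 + m) ∷ [])) + f (2 + m)
  ≡⟨ cong (λ gs → sum gs + f (2 + m)) (map-++ g (map (2 +_) (upTo m)) ((2 + m) ∷ [])) ⟩
    sum (map g (map (2 +_) (upTo m)) ++ g (2 + m) ∷ []) + f (2 + m)
  ≡⟨ cong (_+ f (2 + m)) (trans (sum-++ (map g (map (2 +_) (upTo m))) (g (2 + m) ∷ [])) (cong (A +_) (+-identityʳ (g (2 + m))))) ⟩
    A + g (2 + m) + f (2 + m)
  ≡⟨ trans (+-assoc A _ _) (cong (A +_) (step (2 + m) (s≤s (s≤s z≤n)) ≤-refl)) ⟩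
    A + f (1 + m)
  ≡⟨ telescope f g m (λ t 2≤t t≤m → step t 2≤t (m≤n⇒m≤1+n t≤m)) ⟩
    f 1 ∎
  where
  open ≡-Reasoning
  A : ℕ
  A = sum (map g (map (2 +_) (upTo m)))

threshold : (P : ℕ → Set) → (∀ t → Dec (P t)) → (m : ℕ) → 1 ≤ m
          → (∀ t → 2 ≤ t → suc t ≤ m → P t → P (suc t))
          → ∃ λ i → 1 ≤ i × i ≤ m × (∀ t → 2 ≤ t → t ≤ m → (t ≤ i → ¬ P t) × (i < t → P t))
threshold P P? (suc zero) _ _ = 1 , ≤-refl , ≤-refl , λ t 2≤t t≤1 → ⊥-elim (1+n≰n (≤-trans 2≤t t≤1))
threshold P P? (suc (suc m)) _ up
  with threshold P P? (suc m) (s≤s z≤n) (λ t 2≤t t<m → up t 2≤t (m≤n⇒m≤1+n t<m)) | P? (suc (suc m))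
... | i , 1≤i , i≤m , split | yes Pm = i , 1≤i , m≤n⇒m≤1+n i≤m , split′
  where
  split′ : ∀ t → 2 ≤ t → t ≤ suc (suc m) → (t ≤ i → ¬ P t) × (i < t → P t)
  split′ t 2≤t t≤ with m≤n⇒m<n∨m≡n t≤
  ... | inj₁ t<m = split t 2≤t (≤-pred t<m)
  ... | inj₂ refl = (λ t≤i → ⊥-elim (<⇒≱ (s≤s i≤m) t≤i)) , (λ _ → Pm)
... | i , 1≤i , i≤m , split | no ¬Pm with m≤n⇒m<n∨m≡n i≤m
...   | inj₁ i<m = ⊥-elim (¬Pm (up (suc m) 2≤m ≤-refl (proj₂ (split (suc m) 2≤m ≤-refl) i<m)))
  where
  2≤m : 2 ≤ suc m
  2≤m = s≤s (≤-trans 1≤i (≤-pred i<m))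
...   | inj₂ refl = suc (suc m) , s≤s z≤n , ≤-refl , split′
  where
  split′ : ∀ t → 2 ≤ t → t ≤ suc (suc m) → (t ≤ suc (suc m) → ¬ P t) × (suc (suc m) < t → P t)
  split′ t 2≤t t≤ with m≤n⇒m<n∨m≡n t≤
  ... | inj₁ t<m = (λ _ → proj₁ (split t 2≤t (≤-pred t<m)) (≤-pred t<m)) , (λ m<t → ⊥-elim (<⇒≱ m<t t≤))
  ... | inj₂ refl = (λ _ → ¬Pm) , (λ m<m → ⊥-elim (<-irrefl refl m<m))

crossing : (f : ℕ → ℕ) {a c : ℕ} (b : ℕ) → a ≤ b → f b ≤ c → c < f a
         → ∃ λ t → a < t × t ≤ b × f t ≤ c × c < f (t ∸ 1)
crossing f b a≤b fb≤c c<fa with m≤n⇒m<n∨m≡n a≤b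
... | inj₂ refl = ⊥-elim (<⇒≱ c<fa fb≤c)
crossing f {c = c} (suc b) a≤b fb≤c c<fa | inj₁ a<b with f b ≤? c
... | yes fb≤c′ = let t , a<t , t≤b , rest = crossing f b (≤-pred a<b) fb≤c′ c<fa in t , a<t , m≤n⇒m≤1+n t≤b , rest
... | no fb≰c = suc b , a<b , ≤-refl , fb≤c , ≰⇒> fb≰c

module Decreasing (S : ℕ) (n : ℕ → ℕ) (dec : ∀ i → 1 ≤ i → i < S → n (suc i) < n i) where

  n-< : ∀ {a b} → 1 ≤ a → a < b → b ≤ S → n b < n a
  n-< {a} {suc b} 1≤a a<b b≤S with m≤n⇒m<n∨m≡n (≤-pred a<b)
  ... | inj₂ refl = dec a 1≤a b≤S
  ... | inj₁ a<b′ = <-trans (dec b (≤-trans 1≤a (<⇒≤ a<b′)) b≤S) (n-< 1≤a a<b′ (<⇒≤ b≤S))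

  n-≤ : ∀ {a b} → 1 ≤ a → a ≤ b → b ≤ S → n b ≤ n a
  n-≤ 1≤a a≤b b≤S with m≤n⇒m<n∨m≡n a≤b
  ... | inj₁ a<b = <⇒≤ (n-< 1≤a a<b b≤S)
  ... | inj₂ refl = ≤-refl

  n-injective : ∀ {a b} → 1 ≤ a → a ≤ S → 1 ≤ b → b ≤ S → n a ≡ n b → a ≡ b
  n-injective {a} {b} 1≤a a≤S 1≤b b≤S eq with <-cmp a b
  ... | tri< a<b _ _ = ⊥-elim (<⇒≢ (n-< 1≤a a<b b≤S) (sym eq))
  ... | tri≈ _ a≡b _ = a≡b
  ... | tri> _ _ b<a = ⊥-elim (<⇒≢ (n-< 1≤b b<a a≤S) eq)

∉-triple : ∀ {A : Set} {z a b c : A} → z ≢ a → z ≢ b → z ≢ c → z ∉ (a ∷ b ∷ c ∷ [])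
∉-triple z≢a _ _ (here z≡a) = z≢a z≡a
∉-triple _ z≢b _ (there (here z≡b)) = z≢b z≡b
∉-triple _ _ z≢c (there (there (here z≡c))) = z≢c z≡c

distinctˡ : ∀ {A : Set} {z : A} {e e′} → z ∈ e → z ∉ e′ → DistinctAsSets e e′
distinctˡ z∈e z∉e′ (e⊆e′ , _) = z∉e′ (e⊆e′ z∈e)

distinctʳ : ∀ {A : Set} {z : A} {e e′} → z ∈ e′ → z ∉ e → DistinctAsSets e e′
distinctʳ z∈e′ z∉e (_ , e′⊆e) = z∉e (e′⊆e z∈e′)

≢-resp-≡ : ∀ {A : Set} {a a′ b b′ : A} → a ≡ a′ → b ≡ b′ → a′ ≢ b′ → a ≢ b
≢-resp-≡ refl refl a≢b = a≢b

Apart : ∀ {s} → Vec ℕ s → Vec ℕ s → Set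
Apart x y = ∀ ι → lookup x ι ≢ lookup y ι

allDiffᵇ⇒Apart : ∀ {s} (x y : Vec ℕ s) → allDiffᵇ x y ≡ true → Apart x y
allDiffᵇ⇒Apart (a ∷ x) (b ∷ y) h ι eq with a ≡ᵇ b in a≡ᵇb
allDiffᵇ⇒Apart (a ∷ x) (b ∷ y) () ι eq | true
allDiffᵇ⇒Apart (a ∷ x) (b ∷ y) h Fin.zero eq | false = subst T a≡ᵇb (≡⇒≡ᵇ a b eq)
allDiffᵇ⇒Apart (a ∷ x) (b ∷ y) h (Fin.suc ι) eq | false = allDiffᵇ⇒Apart x y h ι eq

Apart⇒allDiffᵇ : ∀ {s} (x y : Vec ℕ s) → Apart x y → allDiffᵇ x y ≡ true
Apart⇒allDiffᵇ [] [] _ = refl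
Apart⇒allDiffᵇ (a ∷ x) (b ∷ y) apart with a ≡ᵇ b in a≡ᵇb
... | true = ⊥-elim (apart Fin.zero (≡ᵇ⇒≡ a b (subst T (sym a≡ᵇb) _)))
... | false = Apart⇒allDiffᵇ x y (apart ∘ Fin.suc)

module _ {V : Set} (H : MixedHypergraph V) where
  open MixedHypergraph H

  strict-separates : ∀ {k col x y} → IsStrictColoring H k col → (x ∷ y ∷ []) ∈ D → col x ≢ col y
  strict-separates {col = col} {x} {y} (_ , _ , _ , properD) xy∈D col-x≡col-y
    with properD xy∈D
  ... | a , b , a∈ , b∈ , col-a≢col-b = col-a≢col-b (trans (col≡col-x a∈) (sym (col≡col-x b∈)))
    where
    col≡col-x : ∀ {z} → z ∈ (x ∷ y ∷ []) → col z ≡ col x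
    col≡col-x (here refl) = refl
    col≡col-x (there (here refl)) = sym col-x≡col-y

  strict-merges : ∀ {k col a b c} → IsStrictColoring H k col → (a ∷ b ∷ c ∷ []) ∈ C
                → col a ≡ col b ⊎ col a ≡ col c ⊎ col b ≡ col c
  strict-merges (_ , _ , properC , _) abc∈C with properC abc∈C
  ... | _ , _ , here refl , here refl , x≢y , _ = ⊥-elim (x≢y refl)
  ... | _ , _ , here refl , there (here refl) , _ , eq = inj₁ eq
  ... | _ , _ , here refl , there (there (here refl)) , _ , eq = inj₂ (inj₁ eq)
  ... | _ , _ , there (here refl) , here refl , _ , eq = inj₁ (sym eq)
  ... | _ , _ , there (here refl) , there (here refl) , x≢y , _ = ⊥-elim (x≢y refl)
  ... | _ , _ , there (here refl) , there (there (here refl)) , _ , eq = inj₂ (inj₂ eq)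
  ... | _ , _ , there (there (here refl)) , here refl , _ , eq = inj₂ (inj₁ (sym eq))
  ... | _ , _ , there (there (here refl)) , there (here refl) , _ , eq = inj₂ (inj₂ (sym eq))
  ... | _ , _ , there (there (here refl)) , there (there (here refl)) , x≢y , _ = ⊥-elim (x≢y refl)

  samePartition-sym : ∀ {c c′} → SamePartition H c c′ → SamePartition H c′ c
  samePartition-sym same x∈ y∈ = ⇔.sym (same x∈ y∈)

  samePartition-trans : ∀ {c c′ c″} → SamePartition H c c′ → SamePartition H c′ c″ → SamePartition H c c″
  samePartition-trans same same′ x∈ y∈ = ⇔.trans (same x∈ y∈) (same′ x∈ y∈)

  samePartition⇒≤ : ∀ {k k′ c c′} → IsStrictColoring H k c → IsStrictColoring H k′ c′
                  → SamePartition H c c′ → k ≤ k′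
  samePartition⇒≤ {k} {k′} {c} {c′} (_ , onto , _) (c′<k′ , _) same = injective⇒≤ φ-injective
    where
    witness : (a : Fin k) → ∃ λ x → x ∈ X × c x ≡ toℕ a
    witness a = onto (toℕ a) (toℕ<n a)

    φ : Fin k → Fin k′
    φ a = fromℕ< (c′<k′ (proj₁ (proj₂ (witness a))))

    φ-injective : ∀ {a b} → φ a ≡ φ b → a ≡ b
    φ-injective {a} {b} φa≡φb =
      let x , x∈ , c-x≡a = witness a
          y , y∈ , c-y≡b = witness b
      in toℕ-injective (begin
        toℕ a ≡⟨ sym c-x≡a ⟩
        c x   ≡⟨ Equivalence.from (same x∈ y∈) (fromℕ<-injective (c′ x) (c′ y) _ _ φa≡φb) ⟩
        c y   ≡⟨ c-y≡b ⟩
        toℕ b ∎)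
      where open ≡-Reasoning

  samePartition⇒≡ : ∀ {k k′ c c′} → IsStrictColoring H k c → IsStrictColoring H k′ c′
                  → SamePartition H c c′ → k ≡ k′
  samePartition⇒≡ strict strict′ same =
    ≤-antisym (samePartition⇒≤ strict strict′ same) (samePartition⇒≤ strict′ strict (samePartition-sym same))

module Realization (s′ : ℕ) (n : ℕ → ℕ)
  (dec : ∀ i → 1 ≤ i → i < suc s′ → n (suc i) < n i)
  (2≤n[S] : 2 ≤ n (suc s′)) where

  S : ℕ
  S = suc s′

  open Decreasing S n dec
  open Construction S n using (full; diag; u; v)

  X : List (Vec ℕ S)
  X = Xlist S n

  C D : List (List (Vec ℕ S))
  C = Cstar S n
  D = Dstar S n

  H : MixedHypergraph (Vec ℕ S)
  H = Hstar S n

  Level : ℕ → Set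
  Level t = 2 ≤ t × t ≤ S

  -- (t , j) indexes the pair u_t(j), v_t(j) of X.
  Slot : ℕ → ℕ → Set
  Slot t j = Level t × n t ≤ j × j < n (t ∸ 1)

  2≤n : ∀ {p} → 1 ≤ p → p ≤ S → 2 ≤ n p
  2≤n 1≤p p≤S = ≤-trans 2≤n[S] (n-≤ 1≤p p≤S ≤-refl)

  2≤n-level : ∀ {t} → Level t → 2 ≤ n t
  2≤n-level (2≤t , t≤S) = 2≤n (≤-trans (s≤s z≤n) 2≤t) t≤S

  n-level : ∀ {t} → Level t → n t < n (t ∸ 1)
  n-level {suc (suc t)} (_ , t≤S) = dec (suc t) (s≤s z≤n) t≤S
  n-level {suc zero} (s≤s () , _)

  2≤slot : ∀ {t j} → Slot t j → 2 ≤ j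
  2≤slot (level , lo , _) = ≤-trans (2≤n-level level) lo

  1≤slot : ∀ {t j} → Slot t j → 1 ≤ j
  1≤slot slot = ≤-trans (s≤s z≤n) (2≤slot slot)

  slot-pred : ∀ {t j} → Slot t (suc j) → n t < suc j → Slot t j
  slot-pred {j = j} (level , _ , hi) n<j+1 = level , ≤-pred n<j+1 , <-trans (n<1+n j) hi

  slot-unique : ∀ {t t′ c} → Slot t c → Slot t′ c → t ≡ t′
  slot-unique {t} {t′} ((2≤t , t≤S) , lo , hi) ((2≤t′ , t′≤S) , lo′ , hi′) with <-cmp t t′
  ... | tri≈ _ t≡t′ _ = t≡t′
  ... | tri< t<t′ _ _ = ⊥-elim (<⇒≱ hi′ (≤-trans (n-≤ (≤-trans (s≤s z≤n) 2≤t) (<⇒≤∸1 t<t′) (≤-trans (m∸n≤m t′ 1) t′≤S)) lo))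
  ... | tri> _ _ t′<t = ⊥-elim (<⇒≱ hi (≤-trans (n-≤ (≤-trans (s≤s z≤n) 2≤t′) (<⇒≤∸1 t′<t) (≤-trans (m∸n≤m t 1) t≤S)) lo′))

  pos : Fin S → ℕ
  pos ι = suc (toℕ ι)

  lookup-full : ∀ ι → lookup full ι ≡ n (pos ι)
  lookup-full = lookup∘tabulate (n ∘ pos)

  lookup-diag : ∀ c ι → lookup (diag c) ι ≡ c
  lookup-diag c ι = lookup-replicate ι c

  lookup-u-below : ∀ {t j} ι → pos ι < t → lookup (u t j) ι ≡ j
  lookup-u-below {t} {j} ι ι<t = trans (lookup∘tabulate (λ i → if toℕ i <ᵇ t ∸ 1 then j else n (pos i)) ι) (if-<ᵇ-then (suc<⇒<∸1 ι<t))

  lookup-u-above : ∀ {t j} ι → t ≤ pos ι → lookup (u t j) ι ≡ n (pos ι)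
  lookup-u-above {t} {j} ι t≤ι = trans (lookup∘tabulate (λ i → if toℕ i <ᵇ t ∸ 1 then j else n (pos i)) ι) (if-<ᵇ-else (≤suc⇒∸1≤ t≤ι))

  lookup-v-below : ∀ {t j} ι → pos ι < t → lookup (v t j) ι ≡ j
  lookup-v-below {t} {j} ι ι<t = trans (lookup∘tabulate (λ i → if toℕ i <ᵇ t ∸ 1 then j else 1) ι) (if-<ᵇ-then (suc<⇒<∸1 ι<t))

  lookup-v-above : ∀ {t j} ι → t ≤ pos ι → lookup (v t j) ι ≡ 1
  lookup-v-above {t} {j} ι t≤ι = trans (lookup∘tabulate (λ i → if toℕ i <ᵇ t ∸ 1 then j else 1) ι) (if-<ᵇ-else (≤suc⇒∸1≤ t≤ι))

  u-shift : ∀ t → u (suc (suc t)) (n (suc t)) ≡ u (suc t) (n (suc t))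
  u-shift t = tabulate-cong shift
    where
    shift : ∀ ι → (if toℕ ι <ᵇ suc t then n (suc t) else n (pos ι)) ≡ (if toℕ ι <ᵇ t then n (suc t) else n (pos ι))
    shift ι with <-cmp (toℕ ι) t
    ... | tri< ι<t _ _ = trans (if-<ᵇ-then (m<n⇒m<1+n ι<t)) (sym (if-<ᵇ-then ι<t))
    ... | tri≈ _ refl _ = trans (if-<ᵇ-then {m = toℕ ι} ≤-refl) (sym (if-<ᵇ-else {m = toℕ ι} ≤-refl))
    ... | tri> _ _ t<ι = trans (if-<ᵇ-else t<ι) (sym (if-<ᵇ-else (<⇒≤ t<ι)))

  pair : ℕ → ℕ → List (Vec ℕ S)
  pair t j = u t j ∷ v t j ∷ []

  levelVertices : ℕ → List (Vec ℕ S)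
  levelVertices t = concatMap (pair t) (range (n t) (n (t ∸ 1) ∸ 1))

  full∈X : full ∈ X
  full∈X = here refl

  diag∈X : ∀ {c} → 1 ≤ c → c < n S → diag c ∈ X
  diag∈X 1≤c c<n = there (∈-++⁺ˡ (∈-map⁺ diag (∈-range-below⁺ 1≤c c<n)))

  pair⊆X : ∀ {t j x} → Slot t j → x ∈ pair t j → x ∈ X
  pair⊆X {t} ((2≤t , t≤S) , lo , hi) x∈ =
    there (∈-++⁺ʳ _ (∈-concatMap-intro levelVertices (∈-range⁺ 2≤t t≤S)
                       (∈-concatMap-intro (pair t) (∈-range-below⁺ lo hi) x∈)))

  u∈X : ∀ {t j} → Slot t j → u t j ∈ X
  u∈X slot = pair⊆X slot (here refl)

  v∈X : ∀ {t j} → Slot t j → v t j ∈ X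
  v∈X slot = pair⊆X slot (there (here refl))

  u-top∈X : ∀ {t} → Level t → u t (n (t ∸ 1)) ∈ X
  u-top∈X {suc zero} (s≤s () , _)
  u-top∈X {suc (suc zero)} _ = -- u 1 j reduces to full
    subst (_∈ X) (sym (u-shift 0)) full∈X
  u-top∈X {suc (suc (suc t))} (_ , t≤S) = subst (_∈ X) (sym (u-shift (suc t))) (u∈X (level , ≤-refl , n-level level))
    where
    level : Level (suc (suc t))
    level = s≤s (s≤s z≤n) , <⇒≤ t≤S

  u∈X-closed : ∀ {t j} → Level t → n t ≤ j → j ≤ n (t ∸ 1) → u t j ∈ X
  u∈X-closed level lo hi with m≤n⇒m<n∨m≡n hi
  ... | inj₁ hi′ = u∈X (level , lo , hi′)
  ... | inj₂ refl = u-top∈X level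

  data XView : Vec ℕ S → Set where
    full-view : XView full
    diag-view : ∀ {c} → 1 ≤ c → c < n S → XView (diag c)
    u-view : ∀ {t j} → Slot t j → XView (u t j)
    v-view : ∀ {t j} → Slot t j → XView (v t j)

  slot-of : ∀ {t j} → t ∈ range 2 S → j ∈ range (n t) (n (t ∸ 1) ∸ 1) → Slot t j
  slot-of {t} t∈ j∈ = level , ∈-range-below⁻ (≤-trans (s≤s z≤n) (2≤n-level level)) j∈
    where
    level : Level t
    level = ∈-range⁻ 2 S t∈

  pair-view : ∀ {t j x} → Slot t j → x ∈ pair t j → XView x
  pair-view slot (here refl) = u-view slot
  pair-view slot (there (here refl)) = v-view slot

  X-view : ∀ {x} → x ∈ X → XView x
  X-view (here refl) = full-view
  X-view (there x∈) with ∈-++⁻ (map diag (range 1 (n S ∸ 1))) x∈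
  ... | inj₁ x∈diag with ∈-map⁻ diag x∈diag
  ...   | c , c∈ , refl = let 1≤c , c<n = ∈-range-below⁻ ≤-refl c∈ in diag-view 1≤c c<n
  X-view (there x∈) | inj₂ x∈levels with ∈-concatMap-elim levelVertices (range 2 S) x∈levels
  ... | t , t∈ , x∈level with ∈-concatMap-elim (pair t) (range (n t) (n (t ∸ 1) ∸ 1)) x∈level
  ...   | j , j∈ , x∈pair = pair-view (slot-of t∈ j∈) x∈pair

  edgeIfApart : Vec ℕ S → Vec ℕ S → List (List (Vec ℕ S))
  edgeIfApart x y = if allDiffᵇ x y then (x ∷ y ∷ []) ∷ [] else []

  Apart⇒D : ∀ {x y} → x ∈ X → y ∈ X → Apart x y → (x ∷ y ∷ []) ∈ D
  Apart⇒D {x} {y} x∈ y∈ apart =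
    ∈-concatMap-intro (λ x → concatMap (edgeIfApart x) X) x∈ (∈-concatMap-intro (edgeIfApart x) y∈ xy∈)
    where
    xy∈ : (x ∷ y ∷ []) ∈ edgeIfApart x y
    xy∈ rewrite Apart⇒allDiffᵇ x y apart = here refl

  D-view : ∀ {e} → e ∈ D → ∃ λ x → ∃ λ y → x ∈ X × y ∈ X × Apart x y × e ≡ x ∷ y ∷ []
  D-view e∈ with ∈-concatMap-elim (λ x → concatMap (edgeIfApart x) X) X e∈
  ... | x , x∈ , e∈′ with ∈-concatMap-elim (edgeIfApart x) X e∈′
  ... | y , y∈ , e∈″ with allDiffᵇ x y in x#y | e∈″
  ... | true | here refl = x , y , x∈ , y∈ , allDiffᵇ⇒Apart x y x#y , refl

  n[S]≤n : ∀ ι → n S ≤ n (pos ι)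
  n[S]≤n ι = n-≤ (s≤s z≤n) (toℕ<n ι) ≤-refl

  n[t-1]≤n : ∀ {t} ι → pos ι < t → t ≤ S → n (t ∸ 1) ≤ n (pos ι)
  n[t-1]≤n {t} ι ι<t t≤S = n-≤ (s≤s z≤n) (<⇒≤∸1 ι<t) (≤-trans (m∸n≤m t 1) t≤S)

  apart-diag-diag : ∀ {c c′} → c ≢ c′ → Apart (diag c) (diag c′)
  apart-diag-diag {c} {c′} c≢c′ ι rewrite lookup-diag c ι | lookup-diag c′ ι = c≢c′

  apart-diag-full : ∀ {c} → c < n S → Apart (diag c) full
  apart-diag-full {c} c<n ι rewrite lookup-diag c ι | lookup-full ι = <⇒≢ (<-≤-trans c<n (n[S]≤n ι))

  apart-diag-u : ∀ {c t j} → c < n S → Level t → n t ≤ j → Apart (diag c) (u t j)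
  apart-diag-u {c} {t} {j} c<n (2≤t , t≤S) lo ι with pos ι <? t
  ... | yes ι<t rewrite lookup-diag c ι | lookup-u-below {t} {j} ι ι<t =
    <⇒≢ (<-≤-trans c<n (≤-trans (n-≤ (≤-trans (s≤s z≤n) 2≤t) t≤S ≤-refl) lo))
  ... | no ι≮t rewrite lookup-diag c ι | lookup-u-above {t} {j} ι (≮⇒≥ ι≮t) = <⇒≢ (<-≤-trans c<n (n[S]≤n ι))

  apart-full-v : ∀ {t j} → Slot t j → Apart full (v t j)
  apart-full-v {t} {j} ((_ , t≤S) , _ , hi) ι with pos ι <? t
  ... | yes ι<t rewrite lookup-full ι | lookup-v-below {t} {j} ι ι<t = ≢-sym (<⇒≢ (<-≤-trans hi (n[t-1]≤n ι ι<t t≤S)))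
  ... | no ι≮t rewrite lookup-full ι | lookup-v-above {t} {j} ι (≮⇒≥ ι≮t) = ≢-sym (<⇒≢ (2≤n (s≤s z≤n) (toℕ<n ι)))

  apart-u-v : ∀ {t j t′ j′} → Level t → n t ≤ j → Slot t′ j′ → j ≢ j′ → Apart (u t j) (v t′ j′)
  apart-u-v {t} {j} {t′} {j′} level lo ((_ , t′≤S) , _ , hi′) j≢j′ ι with pos ι <? t | pos ι <? t′
  ... | yes ι<t | yes ι<t′ rewrite lookup-u-below {t} {j} ι ι<t | lookup-v-below {t′} {j′} ι ι<t′ = j≢j′
  ... | yes ι<t | no ι≮t′ rewrite lookup-u-below {t} {j} ι ι<t | lookup-v-above {t′} {j′} ι (≮⇒≥ ι≮t′) =
    ≢-sym (<⇒≢ (≤-trans (2≤n-level level) lo))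
  ... | no ι≮t | yes ι<t′ rewrite lookup-u-above {t} {j} ι (≮⇒≥ ι≮t) | lookup-v-below {t′} {j′} ι ι<t′ =
    ≢-sym (<⇒≢ (<-≤-trans hi′ (n[t-1]≤n ι ι<t′ t′≤S)))
  ... | no ι≮t | no ι≮t′ rewrite lookup-u-above {t} {j} ι (≮⇒≥ ι≮t) | lookup-v-above {t′} {j′} ι (≮⇒≥ ι≮t′) =
    ≢-sym (<⇒≢ (2≤n (s≤s z≤n) (toℕ<n ι)))

  uvv vuu : ℕ → ℕ → List (Vec ℕ S)
  uvv t j = u t j ∷ v t j ∷ v t (j ∸ 1) ∷ []
  vuu t j = v t j ∷ u t j ∷ u t (suc j) ∷ []

  base : ℕ → List (Vec ℕ S)
  base t = u t (n t) ∷ v t (n t) ∷ diag 1 ∷ []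

  uvvEdges vuuEdges levelEdges : ℕ → List (List (Vec ℕ S))
  uvvEdges t = map (uvv t) (range (suc (n t)) (n (t ∸ 1) ∸ 1))
  vuuEdges t = map (vuu t) (range (n t) (n (t ∸ 1) ∸ 1))
  levelEdges t = uvvEdges t ++ vuuEdges t ++ base t ∷ []

  levelEdges⊆C : ∀ {t e} → Level t → e ∈ levelEdges t → e ∈ C
  levelEdges⊆C (2≤t , t≤S) = ∈-concatMap-intro levelEdges (∈-range⁺ 2≤t t≤S)

  uvv∈C : ∀ {t j} → Slot t j → n t < j → uvv t j ∈ C
  uvv∈C {t} (level , _ , hi) lo = levelEdges⊆C level (∈-++⁺ˡ (∈-map⁺ (uvv t) (∈-range-below⁺ lo hi)))

  vuu∈C : ∀ {t j} → Slot t j → vuu t j ∈ C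
  vuu∈C {t} (level , lo , hi) = levelEdges⊆C level (∈-++⁺ʳ (uvvEdges t) (∈-++⁺ˡ (∈-map⁺ (vuu t) (∈-range-below⁺ lo hi))))

  base∈C : ∀ {t} → Level t → base t ∈ C
  base∈C {t} level = levelEdges⊆C level (∈-++⁺ʳ (uvvEdges t) (∈-++⁺ʳ (vuuEdges t) (here refl)))

  data EdgeOf (t : ℕ) : List (Vec ℕ S) → Set where
    uvv-edge : ∀ {j} → Slot t j → n t < j → EdgeOf t (uvv t j)
    vuu-edge : ∀ {j} → Slot t j → EdgeOf t (vuu t j)
    base-edge : Level t → EdgeOf t (base t)

  levelEdges-view : ∀ {t e} → Level t → e ∈ levelEdges t → EdgeOf t e
  levelEdges-view {t} level e∈ with ∈-++⁻ (uvvEdges t) e∈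
  ... | inj₁ e∈uvv with ∈-map⁻ (uvv t) e∈uvv
  ...   | j , j∈ , refl = let lo , hi = ∈-range-below⁻ (s≤s z≤n) j∈ in uvv-edge (level , <⇒≤ lo , hi) lo
  levelEdges-view {t} level e∈ | inj₂ e∈′ with ∈-++⁻ (vuuEdges t) e∈′
  ... | inj₁ e∈vuu with ∈-map⁻ (vuu t) e∈vuu
  ...   | j , j∈ , refl = vuu-edge (level , ∈-range-below⁻ (≤-trans (s≤s z≤n) (2≤n-level level)) j∈)
  levelEdges-view level e∈ | inj₂ e∈′ | inj₂ (here refl) = base-edge level

  C-view : ∀ {e} → e ∈ C → ∃ λ t → EdgeOf t e
  C-view e∈ with ∈-concatMap-elim levelEdges (range 2 S) e∈
  ... | t , t∈ , e∈level = t , levelEdges-view (∈-range⁻ 2 S t∈) e∈level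

  coordinate : ∀ {t} → 1 ≤ t → t ≤ S → ∃ λ ι → pos ι ≡ t
  coordinate {suc t} _ t<S = fromℕ< t<S , cong suc (toℕ-fromℕ< t<S)

  last : Fin S
  last = fromℕ< ≤-refl

  pos-last : pos last ≡ S
  pos-last = cong suc (toℕ-fromℕ< ≤-refl)

  lookup-u-last : ∀ {t j} → t ≤ S → lookup (u t j) last ≡ n S
  lookup-u-last {t} t≤S = trans (lookup-u-above last (subst (t ≤_) (sym pos-last) t≤S)) (cong n pos-last)

  lookup-v-last : ∀ {t j} → t ≤ S → lookup (v t j) last ≡ 1
  lookup-v-last {t} t≤S = lookup-v-above last (subst (t ≤_) (sym pos-last) t≤S)

  u≢v : ∀ {t j t′ j′} → t ≤ S → t′ ≤ S → u t j ≢ v t′ j′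
  u≢v t≤S t′≤S u≡v =
    <⇒≢ 2≤n[S] (trans (sym (lookup-v-last t′≤S)) (trans (cong (λ x → lookup x last) (sym u≡v)) (lookup-u-last t≤S)))

  u≢diag1 : ∀ {t j} → t ≤ S → u t j ≢ diag 1
  u≢diag1 t≤S u≡diag =
    <⇒≢ 2≤n[S] (trans (sym (lookup-diag 1 last)) (trans (cong (λ x → lookup x last) (sym u≡diag)) (lookup-u-last t≤S)))

  u-injective : ∀ {t j j′} → 2 ≤ t → u t j ≡ u t j′ → j ≡ j′
  u-injective {t} {j} {j′} 2≤t eq =
    trans (sym (lookup-u-below {t} {j} Fin.zero 2≤t)) (trans (cong (λ x → lookup x Fin.zero) eq) (lookup-u-below Fin.zero 2≤t))

  v-injective : ∀ {t j j′} → 2 ≤ t → v t j ≡ v t j′ → j ≡ j′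
  v-injective {t} {j} {j′} 2≤t eq =
    trans (sym (lookup-v-below {t} {j} Fin.zero 2≤t)) (trans (cong (λ x → lookup x Fin.zero) eq) (lookup-v-below Fin.zero 2≤t))

  v≢u : ∀ {t j t′ j′} → t ≤ S → t′ ≤ S → v t j ≢ u t′ j′
  v≢u t≤S t′≤S = ≢-sym (u≢v t′≤S t≤S)

  v≢v : ∀ {t j j′} → 2 ≤ t → j ≢ j′ → v t j ≢ v t j′
  v≢v 2≤t j≢j′ = j≢j′ ∘ v-injective 2≤t

  v≢diag1 : ∀ {t j} → 2 ≤ t → 2 ≤ j → v t j ≢ diag 1
  v≢diag1 {t} {j} 2≤t 2≤j eq = <⇒≢ 2≤j (sym (begin
    j                     ≡⟨ sym (lookup-v-below Fin.zero 2≤t) ⟩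
    lookup (v t j) Fin.zero ≡⟨ cong (λ x → lookup x Fin.zero) eq ⟩
    lookup (diag 1) Fin.zero ≡⟨ lookup-diag 1 Fin.zero ⟩
    1                     ∎))
    where open ≡-Reasoning

  v≢v-level : ∀ {t t′ j j′} → 2 ≤ t → t < t′ → t′ ≤ S → 2 ≤ j′ → v t j ≢ v t′ j′
  v≢v-level {t} {t′} {j} {j′} 2≤t t<t′ t′≤S 2≤j′ eq with coordinate (≤-trans (s≤s z≤n) 2≤t) (<⇒≤ (<-≤-trans t<t′ t′≤S))
  ... | ι , ι≡t = <⇒≢ 2≤j′ (begin
    1                  ≡⟨ sym (lookup-v-above ι (≤-reflexive (sym ι≡t))) ⟩
    lookup (v t j) ι   ≡⟨ cong (λ x → lookup x ι) eq ⟩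
    lookup (v t′ j′) ι ≡⟨ lookup-v-below ι (subst (_< t′) (sym ι≡t) t<t′) ⟩
    j′                 ∎)
    where open ≡-Reasoning

  module Colouring {k : ℕ} {col : Vec ℕ S → ℕ} (strict : IsStrictColoring H k col) where

    separated : ∀ {x y} → x ∈ X → y ∈ X → Apart x y → col x ≢ col y
    separated x∈ y∈ apart = strict-separates H strict (Apart⇒D x∈ y∈ apart)

    u≁v : ∀ {t j t′ j′} → Level t → n t ≤ j → j ≤ n (t ∸ 1) → Slot t′ j′ → j ≢ j′ → col (u t j) ≢ col (v t′ j′)
    u≁v level lo hi slot′ j≢j′ = separated (u∈X-closed level lo hi) (v∈X slot′) (apart-u-v level lo slot′ j≢j′)

    diag≁full : ∀ {c} → 1 ≤ c → c < n S → col (diag c) ≢ col full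
    diag≁full 1≤c c<n = separated (diag∈X 1≤c c<n) full∈X (apart-diag-full c<n)

    diag≁u : ∀ {c t j} → 1 ≤ c → c < n S → Slot t j → col (diag c) ≢ col (u t j)
    diag≁u 1≤c c<n slot@(level , lo , _) = separated (diag∈X 1≤c c<n) (u∈X slot) (apart-diag-u c<n level lo)

    full≁v : ∀ {t j} → Slot t j → col full ≢ col (v t j)
    full≁v slot = separated full∈X (v∈X slot) (apart-full-v slot)

    Merged : ℕ → Set
    Merged t = col (u t (n t)) ≡ col (v t (n t))

    merged-chain : ∀ {t} → Merged t → ∀ {j} → Slot t j → col (u t j) ≡ col (v t j)
    merged-chain merged {zero} slot with 1≤slot slot
    ... | ()
    merged-chain {t} merged {suc j} slot@(level , lo , hi) with m≤n⇒m<n∨m≡n lo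
    ... | inj₂ n≡j+1 = subst (λ j → col (u t j) ≡ col (v t j)) n≡j+1 merged
    ... | inj₁ n<j+1 with strict-merges H strict (uvv∈C slot n<j+1)
    ...   | inj₁ uj+1~vj+1 = uj+1~vj+1
    ...   | inj₂ (inj₁ uj+1~vj) = ⊥-elim (u≁v level lo (<⇒≤ hi) (slot-pred slot n<j+1) 1+n≢n uj+1~vj)
    ...   | inj₂ (inj₂ vj+1~vj) =
      ⊥-elim (u≁v level (≤-pred n<j+1) (<⇒≤ (<-trans (n<1+n j) hi)) slot (≢-sym 1+n≢n)
                  (trans (merged-chain merged (slot-pred slot n<j+1)) (sym vj+1~vj)))

    module Split {t} (level : Level t) (split : ¬ Merged t) where

      diag1≁u-base : col (diag 1) ≢ col (u t (n t))
      diag1≁u-base = diag≁u ≤-refl 2≤n[S] (level , ≤-refl , n-level level)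

      v-base : col (v t (n t)) ≡ col (diag 1)
      v-base with strict-merges H strict (base∈C level)
      ... | inj₁ merged = ⊥-elim (split merged)
      ... | inj₂ (inj₁ u~diag) = ⊥-elim (diag1≁u-base (sym u~diag))
      ... | inj₂ (inj₂ v~diag) = v~diag

      Invariant : ℕ → Set
      Invariant j = col (v t j) ≡ col (diag 1) × col (u t j) ≡ col (u t (n t))

      u-step : ∀ {j} → Slot t j → Invariant j → col (u t (suc j)) ≡ col (u t (n t))
      u-step slot@(_ , lo , hi) (v~diag , u~base) with strict-merges H strict (vuu∈C slot)
      ... | inj₁ v~u = ⊥-elim (diag1≁u-base (trans (sym v~diag) (trans v~u u~base)))
      ... | inj₂ (inj₁ v~u′) = ⊥-elim (u≁v level (≤-trans lo (n≤1+n _)) hi slot 1+n≢n (sym v~u′))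
      ... | inj₂ (inj₂ u~u′) = trans (sym u~u′) u~base

      v-step : ∀ {j} → Slot t (suc j) → n t < suc j → Invariant j → col (u t (suc j)) ≡ col (u t (n t))
             → col (v t (suc j)) ≡ col (diag 1)
      v-step slot@(_ , _ , hi) n<j+1 (v~diag , u~base) u′~base with strict-merges H strict (uvv∈C slot n<j+1)
      ... | inj₁ u′~v′ = ⊥-elim (u≁v level (≤-pred n<j+1) (<⇒≤ (<-trans (n<1+n _) hi)) slot (≢-sym 1+n≢n)
                                     (trans u~base (trans (sym u′~base) u′~v′)))
      ... | inj₂ (inj₁ u′~v) = ⊥-elim (diag1≁u-base (trans (sym v~diag) (trans (sym u′~v) u′~base)))
      ... | inj₂ (inj₂ v′~v) = trans v′~v v~diag

      split-chain : ∀ {j} → Slot t j → Invariant j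
      split-chain {zero} slot with 1≤slot slot
      ... | ()
      split-chain {suc j} slot@(_ , lo , _) with m≤n⇒m<n∨m≡n lo
      ... | inj₂ n≡j+1 = subst Invariant n≡j+1 (v-base , refl)
      ... | inj₁ n<j+1 = v-step slot n<j+1 invariant u~base , u~base
        where
        invariant : Invariant j
        invariant = split-chain (slot-pred slot n<j+1)
        u~base : col (u t (suc j)) ≡ col (u t (n t))
        u~base = u-step (slot-pred slot n<j+1) invariant

      split-chain-u : ∀ {j} → n t ≤ j → j ≤ n (t ∸ 1) → col (u t j) ≡ col (u t (n t))
      split-chain-u {zero} lo _ with ≤-trans (2≤n-level level) lo
      ... | ()
      split-chain-u {suc j} lo hi with m≤n⇒m<n∨m≡n lo
      ... | inj₂ n≡j+1 = cong (col ∘ u t) (sym n≡j+1)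
      ... | inj₁ n<j+1 = u-step slot-j (split-chain slot-j)
        where
        slot-j : Slot t j
        slot-j = level , ≤-pred n<j+1 , hi

      u~u-top : ∀ {j} → n t ≤ j → j ≤ n (t ∸ 1) → col (u t j) ≡ col (u t (n (t ∸ 1)))
      u~u-top lo hi = trans (split-chain-u lo hi) (sym (split-chain-u (<⇒≤ (n-level level)) ≤-refl))

    merged-step : ∀ t → 2 ≤ t → suc t ≤ S → Merged t → Merged (suc t)
    merged-step (suc t) 2≤t t<S merged = decidable-stable (_ ≟ _) λ split →
      let open Split level′ split in
      u≁v level′ (<⇒≤∸1 (n-level level′)) (m∸n≤m (n (suc t)) 1) (level , ≤-refl , n-level level)
          (<⇒≢ (m∸1<m (≤-trans (s≤s z≤n) (2≤n-level level))))
          (begin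
            col (u (suc (suc t)) (n (suc t) ∸ 1)) ≡⟨ u~u-top (<⇒≤∸1 (n-level level′)) (m∸n≤m (n (suc t)) 1) ⟩
            col (u (suc (suc t)) (n (suc t)))     ≡⟨ cong col (u-shift t) ⟩
            col (u (suc t) (n (suc t)))           ≡⟨ merged ⟩
            col (v (suc t) (n (suc t)))           ∎)
      where
      open ≡-Reasoning
      level : Level (suc t)
      level = 2≤t , <⇒≤ t<S
      level′ : Level (suc (suc t))
      level′ = ≤-trans 2≤t (n≤1+n _) , t<S

    merged-threshold : ∃ λ i → 1 ≤ i × i ≤ S × (∀ t → 2 ≤ t → t ≤ S → (t ≤ i → ¬ Merged t) × (i < t → Merged t))
    merged-threshold = threshold Merged (λ t → col (u t (n t)) ≟ col (v t (n t))) S (s≤s z≤n) merged-step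

    module AtThreshold (ι : Fin S) (boundary : ∀ {t} → Level t → (t ≤ pos ι → ¬ Merged t) × (pos ι < t → Merged t)) where

      split-below : ∀ {t} → Level t → t ≤ pos ι → ¬ Merged t
      split-below level = proj₁ (boundary level)

      merged-above : ∀ {t} → Level t → pos ι < t → Merged t
      merged-above level = proj₂ (boundary level)

      u~u-shift : ∀ {t j} → Level (suc (suc t)) → suc (suc t) ≤ pos ι → n (suc (suc t)) ≤ j → j ≤ n (suc t)
                → col (u (suc (suc t)) j) ≡ col (u (suc t) (n (suc t)))
      u~u-shift {t} level t≤ι lo hi =
        trans (Split.u~u-top level (split-below level t≤ι) lo hi) (cong col (u-shift t))

      u-colour-below : ∀ {t j} → Level t → t ≤ pos ι → n t ≤ j → j ≤ n (t ∸ 1) → col (u t j) ≡ col full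
      u-colour-below {suc zero} (s≤s () , _)
      u-colour-below {suc (suc zero)} level t≤ι lo hi = u~u-shift level t≤ι lo hi -- u 1 (n 1) reduces to full
      u-colour-below {suc (suc (suc t))} level@(2≤t , t≤S) t≤ι lo hi =
        trans (u~u-shift level t≤ι lo hi) (u-colour-below level′ (≤-trans (n≤1+n _) t≤ι) ≤-refl (<⇒≤ (n-level level′)))
        where
        level′ : Level (suc (suc t))
        level′ = s≤s (s≤s z≤n) , <⇒≤ t≤S

      u~v-above : ∀ {t j} → Slot t j → pos ι < t → col (u t j) ≡ col (v t j)
      u~v-above slot@(level , _) ι<t = merged-chain (merged-above level ι<t) slot

      -- x has the colour of the canonical vertex with its ι-th coordinate c:
      -- diag c, full, or u t c for a level t above ι.
      data Kind (x : Vec ℕ S) : Set where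
        small : ∀ {c} → 1 ≤ c → c < n S → lookup x ι ≡ c → col x ≡ col (diag c) → Kind x
        top : lookup x ι ≡ n (pos ι) → col x ≡ col full → Kind x
        middle : ∀ {t c} → Slot t c → pos ι < t → lookup x ι ≡ c → col x ≡ col (u t c) → Kind x

      kind : ∀ {x} → x ∈ X → Kind x
      kind x∈ with X-view x∈
      ... | full-view = top (lookup-full ι) refl
      ... | diag-view 1≤c c<n = small 1≤c c<n (lookup-diag _ ι) refl
      ... | u-view {t} slot@(level , lo , hi) with t ≤? pos ι
      ...   | yes t≤ι = top (lookup-u-above ι t≤ι) (u-colour-below level t≤ι lo (<⇒≤ hi))
      ...   | no t≰ι = middle slot (≰⇒> t≰ι) (lookup-u-below ι (≰⇒> t≰ι)) refl
      kind x∈ | v-view {t} slot@(level , _) with t ≤? pos ι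
      ...   | yes t≤ι = small ≤-refl 2≤n[S] (lookup-v-above ι t≤ι) (proj₁ (Split.split-chain level (split-below level t≤ι) slot))
      ...   | no t≰ι = middle slot (≰⇒> t≰ι) (lookup-v-below ι (≰⇒> t≰ι)) (sym (u~v-above slot (≰⇒> t≰ι)))

      small≢top : ∀ {c} → c < n S → c ≢ n (pos ι)
      small≢top c<n = <⇒≢ (<-≤-trans c<n (n[S]≤n ι))

      small≢middle : ∀ {c t c′} → c < n S → Slot t c′ → c ≢ c′
      small≢middle c<n (level@(2≤t , t≤S) , lo , _) = <⇒≢ (<-≤-trans c<n (≤-trans (n-≤ (≤-trans (s≤s z≤n) 2≤t) t≤S ≤-refl) lo))

      middle≢top : ∀ {t c} → Slot t c → pos ι < t → c ≢ n (pos ι)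
      middle≢top ((_ , t≤S) , _ , hi) ι<t = <⇒≢ (<-≤-trans hi (n[t-1]≤n ι ι<t t≤S))

      coordinate≡⇒colour≡ : ∀ {x y} → Kind x → Kind y → lookup x ι ≡ lookup y ι → col x ≡ col y
      coordinate≡⇒colour≡ (small _ _ refl x~) (small _ _ refl y~) same = trans x~ (trans (cong (col ∘ diag) same) (sym y~))
      coordinate≡⇒colour≡ (top _ x~) (top _ y~) _ = trans x~ (sym y~)
      coordinate≡⇒colour≡ (middle slot _ ex x~) (middle slot′ _ ey y~) same with trans (sym ex) (trans same ey)
      ... | refl with slot-unique slot slot′
      ...   | refl = trans x~ (sym y~)
      coordinate≡⇒colour≡ (small _ c<n refl _) (top ey _) same = ⊥-elim (small≢top c<n (trans same ey))
      coordinate≡⇒colour≡ (small _ c<n refl _) (middle slot _ refl _) same = ⊥-elim (small≢middle c<n slot same)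
      coordinate≡⇒colour≡ (top ex _) (middle slot ι<t refl _) same = ⊥-elim (middle≢top slot ι<t (trans (sym same) ex))
      coordinate≡⇒colour≡ (top ex _) (small _ c<n refl _) same = ⊥-elim (small≢top c<n (trans (sym same) ex))
      coordinate≡⇒colour≡ (middle slot _ refl _) (small _ c<n refl _) same = ⊥-elim (small≢middle c<n slot (sym same))
      coordinate≡⇒colour≡ (middle slot ι<t refl _) (top ey _) same = ⊥-elim (middle≢top slot ι<t (trans same ey))

      coordinate≢⇒colour≢ : ∀ {x y} → Kind x → Kind y → lookup x ι ≢ lookup y ι → col x ≢ col y
      coordinate≢⇒colour≢ (small 1≤c c<n refl x~) (small 1≤c′ c′<n refl y~) ne =
        ≢-resp-≡ x~ y~ (separated (diag∈X 1≤c c<n) (diag∈X 1≤c′ c′<n) (apart-diag-diag ne))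
      coordinate≢⇒colour≢ (small 1≤c c<n _ x~) (top _ y~) _ = ≢-resp-≡ x~ y~ (diag≁full 1≤c c<n)
      coordinate≢⇒colour≢ (small 1≤c c<n _ x~) (middle slot _ _ y~) _ = ≢-resp-≡ x~ y~ (diag≁u 1≤c c<n slot)
      coordinate≢⇒colour≢ (top ex _) (top ey _) ne = ⊥-elim (ne (trans ex (sym ey)))
      coordinate≢⇒colour≢ (top _ x~) (middle slot ι<t _ y~) _ = ≢-resp-≡ x~ (trans y~ (u~v-above slot ι<t)) (full≁v slot)
      coordinate≢⇒colour≢ (middle (level , lo , hi) _ ex x~) (middle slot′ ι<t′ ey y~) ne =
        ≢-resp-≡ x~ (trans y~ (u~v-above slot′ ι<t′))
                 (u≁v level lo (<⇒≤ hi) slot′ (λ c≡c′ → ne (trans ex (trans c≡c′ (sym ey)))))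
      coordinate≢⇒colour≢ (top _ x~) (small 1≤c c<n _ y~) _ = ≢-resp-≡ x~ y~ (≢-sym (diag≁full 1≤c c<n))
      coordinate≢⇒colour≢ (middle slot _ _ x~) (small 1≤c c<n _ y~) _ = ≢-resp-≡ x~ y~ (≢-sym (diag≁u 1≤c c<n slot))
      coordinate≢⇒colour≢ (middle slot ι<t _ x~) (top _ y~) _ = ≢-resp-≡ (trans x~ (u~v-above slot ι<t)) y~ (≢-sym (full≁v slot))

      colour⇔coordinate : ∀ {x y} → x ∈ X → y ∈ X → (col x ≡ col y) ⇔ (lookup x ι ≡ lookup y ι)
      colour⇔coordinate x∈ y∈ =
        mk⇔ (λ same → decidable-stable (_ ≟ _) (λ ne → coordinate≢⇒colour≢ (kind x∈) (kind y∈) ne same)) (coordinate≡⇒colour≡ (kind x∈) (kind y∈))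

  module Coordinate (ι : Fin S) where

    -- Coordinates range over 1 … n_i, colours over 0 … n_i - 1.
    colour : Vec ℕ S → ℕ
    colour x = lookup x ι ∸ 1

    InRange : ℕ → Set
    InRange c = 1 ≤ c × c ≤ n (pos ι)

    top-inRange : InRange (n (pos ι))
    top-inRange = ≤-trans (s≤s z≤n) (2≤n (s≤s z≤n) (toℕ<n ι)) , ≤-refl

    slot-inRange : ∀ {t j} → Slot t j → pos ι < t → InRange j
    slot-inRange slot@((_ , t≤S) , _ , hi) ι<t = 1≤slot slot , <⇒≤ (<-≤-trans hi (n[t-1]≤n ι ι<t t≤S))

    coordinate-inRange : ∀ {x} → x ∈ X → InRange (lookup x ι)
    coordinate-inRange x∈ with X-view x∈
    ... | full-view rewrite lookup-full ι = top-inRange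
    ... | diag-view {c} 1≤c c<n rewrite lookup-diag c ι = 1≤c , <⇒≤ (<-≤-trans c<n (n[S]≤n ι))
    ... | u-view {t} {j} slot with pos ι <? t
    ...   | yes ι<t rewrite lookup-u-below {t} {j} ι ι<t = slot-inRange slot ι<t
    ...   | no ι≮t rewrite lookup-u-above {t} {j} ι (≮⇒≥ ι≮t) = top-inRange
    coordinate-inRange x∈ | v-view {t} {j} slot with pos ι <? t
    ...   | yes ι<t rewrite lookup-v-below {t} {j} ι ι<t = slot-inRange slot ι<t
    ...   | no ι≮t rewrite lookup-v-above {t} {j} ι (≮⇒≥ ι≮t) = ≤-refl , proj₁ top-inRange

    coordinate-attained : ∀ {c} → InRange c → ∃ λ x → x ∈ X × lookup x ι ≡ c
    coordinate-attained {c} (1≤c , c≤n) with c <? n S | c ≟ n (pos ι)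
    ... | yes c<n | _ = diag c , diag∈X 1≤c c<n , lookup-diag c ι
    ... | no _ | yes c≡n = full , full∈X , trans (lookup-full ι) (sym c≡n)
    ... | no c≮n | no c≢n with crossing n S (toℕ<n ι) (≮⇒≥ c≮n) (≤∧≢⇒< c≤n c≢n)
    ...   | t , ι<t , t≤S , lo , hi = u t c , u∈X ((≤-trans (s≤s (s≤s z≤n)) ι<t , t≤S) , lo , hi) , lookup-u-below ι ι<t

    C-coordinate : ∀ {e} → e ∈ C → ∃ λ x → ∃ λ y → x ∈ e × y ∈ e × x ≢ y × lookup x ι ≡ lookup y ι
    C-coordinate e∈ with C-view e∈
    ... | t , uvv-edge {j} slot@((2≤t , t≤S) , _) n<j with pos ι <? t
    ...   | yes ι<t = u t j , v t j , here refl , there (here refl) , u≢v t≤S t≤S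
                    , trans (lookup-u-below ι ι<t) (sym (lookup-v-below ι ι<t))
    ...   | no ι≮t = v t j , v t (j ∸ 1) , there (here refl) , there (there (here refl))
                   , v≢v 2≤t (≢-sym (<⇒≢ (m∸1<m (1≤slot slot))))
                   , trans (lookup-v-above ι (≮⇒≥ ι≮t)) (sym (lookup-v-above ι (≮⇒≥ ι≮t)))
    C-coordinate e∈ | t , vuu-edge {j} ((2≤t , t≤S) , _) with pos ι <? t
    ...   | yes ι<t = v t j , u t j , here refl , there (here refl) , v≢u t≤S t≤S
                    , trans (lookup-v-below ι ι<t) (sym (lookup-u-below ι ι<t))
    ...   | no ι≮t = u t j , u t (suc j) , there (here refl) , there (there (here refl))
                   , (λ eq → 1+n≢n (sym (u-injective 2≤t eq)))
                   , trans (lookup-u-above ι (≮⇒≥ ι≮t)) (sym (lookup-u-above ι (≮⇒≥ ι≮t)))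
    C-coordinate e∈ | t , base-edge level@(2≤t , t≤S) with pos ι <? t
    ...   | yes ι<t = u t (n t) , v t (n t) , here refl , there (here refl) , u≢v t≤S t≤S
                    , trans (lookup-u-below ι ι<t) (sym (lookup-v-below ι ι<t))
    ...   | no ι≮t = v t (n t) , diag 1 , there (here refl) , there (there (here refl))
                   , v≢diag1 2≤t (2≤n-level level)
                   , trans (lookup-v-above ι (≮⇒≥ ι≮t)) (sym (lookup-diag 1 ι))

    strict : IsStrictColoring H (n (pos ι)) colour
    strict = (λ x∈ → m∸1<n (coordinate-inRange x∈))
           , (λ i i<n → let x , x∈ , x≡ = coordinate-attained (s≤s z≤n , i<n) in x , x∈ , cong (_∸ 1) x≡)
           , (λ e∈ → let x , y , x∈ , y∈ , x≢y , same = C-coordinate e∈ in x , y , x∈ , y∈ , x≢y , cong (_∸ 1) same)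
           , D-separated
      where
      m∸1<n : ∀ {m} → InRange m → m ∸ 1 < n (pos ι)
      m∸1<n (1≤m , m≤n) = <-≤-trans (m∸1<m 1≤m) m≤n

      D-separated : ∀ {e} → e ∈ D → ∃ λ x → ∃ λ y → x ∈ e × y ∈ e × colour x ≢ colour y
      D-separated e∈ with D-view e∈
      ... | x , y , x∈ , y∈ , apart , refl =
        x , y , here refl , there (here refl) ,
        λ same → apart ι (∸1-injective (proj₁ (coordinate-inRange x∈)) (proj₁ (coordinate-inRange y∈)) same)

    samePartition-coordinate : ∀ {col} → (∀ {x y} → x ∈ X → y ∈ X → (col x ≡ col y) ⇔ (lookup x ι ≡ lookup y ι))
                             → SamePartition H col colour
    samePartition-coordinate col⇔ x∈ y∈ =
      ⇔.trans (col⇔ x∈ y∈)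
        (mk⇔ (cong (_∸ 1)) (∸1-injective (proj₁ (coordinate-inRange x∈)) (proj₁ (coordinate-inRange y∈))))

  classify : ∀ {k col} → IsStrictColoring H k col
           → ∃ λ ι → k ≡ n (pos ι) × SamePartition H col (Coordinate.colour ι)
  classify {k} {col} strict with Colouring.merged-threshold strict
  ... | i , 1≤i , i≤S , boundary with coordinate 1≤i i≤S
  ... | ι , refl = ι , samePartition⇒≡ H strict (Coordinate.strict ι) same , same
    where
    same : SamePartition H col (Coordinate.colour ι)
    same = Coordinate.samePartition-coordinate ι
             (Colouring.AtThreshold.colour⇔coordinate strict ι (λ (2≤t , t≤S) → boundary _ 2≤t t≤S))

  oneRealization : OneRealization H (λ k → ∃[ i ] (1 ≤ i × i ≤ S × n i ≡ k))
  oneRealization = (λ k → mk⇔ feasible⇒level level⇒feasible) , unique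
    where
    feasible⇒level : ∀ {k} → Feasible H k → ∃[ i ] (1 ≤ i × i ≤ S × n i ≡ k)
    feasible⇒level (_ , strict) with classify strict
    ... | ι , k≡n , _ = pos ι , s≤s z≤n , toℕ<n ι , sym k≡n

    level⇒feasible : ∀ {k} → ∃[ i ] (1 ≤ i × i ≤ S × n i ≡ k) → Feasible H k
    level⇒feasible (i , 1≤i , i≤S , refl) with coordinate 1≤i i≤S
    ... | ι , refl = Coordinate.colour ι , Coordinate.strict ι

    unique : ∀ k → ∃[ i ] (1 ≤ i × i ≤ S × n i ≡ k)
           → ∀ c c′ → IsStrictColoring H k c → IsStrictColoring H k c′ → SamePartition H c c′
    unique k _ c c′ strict strict′ with classify strict | classify strict′
    ... | ι , k≡n , same | ι′ , k≡n′ , same′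
      with toℕ-injective (suc-injective (n-injective (s≤s z≤n) (toℕ<n ι) (s≤s z≤n) (toℕ<n ι′) (trans (sym k≡n) k≡n′)))
    ... | refl = samePartition-trans H same (samePartition-sym H same′)

  length-levelEdges : ∀ {t} → Level t → length (levelEdges t) ≡ 2 * (n (t ∸ 1) ∸ n t)
  length-levelEdges {t} level = begin
      length (levelEdges t)
    ≡⟨ length-++ (uvvEdges t) ⟩
      length (uvvEdges t) + length (vuuEdges t ++ base t ∷ [])
    ≡⟨ cong₂ _+_ (trans (length-map (uvv t) (range (suc (n t)) top)) (length-range (suc (n t)) top))
                 (trans (length-++ (vuuEdges t)) (cong (_+ 1) (trans (length-map (vuu t) (range (n t) top)) (length-range (n t) top)))) ⟩
      (n (t ∸ 1) ∸ 1 ∸ n t) + ((suc (n (t ∸ 1) ∸ 1) ∸ n t) + 1)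
    ≡⟨ band-size (n-level level) ⟩
      2 * (n (t ∸ 1) ∸ n t) ∎
    where
    open ≡-Reasoning
    top : ℕ
    top = n (t ∸ 1) ∸ 1
    band-size : ∀ {a m} → a < m → (m ∸ 1 ∸ a) + ((suc (m ∸ 1) ∸ a) + 1) ≡ 2 * (m ∸ a)
    band-size {a} {suc m} (s≤s a≤m) rewrite +-∸-assoc 1 a≤m = begin
      (m ∸ a) + (suc (m ∸ a) + 1) ≡⟨ +-suc (m ∸ a) _ ⟩
      suc ((m ∸ a) + ((m ∸ a) + 1)) ≡⟨ cong (λ d → suc ((m ∸ a) + d)) (+-comm (m ∸ a) 1) ⟩
      suc ((m ∸ a) + suc (m ∸ a)) ≡⟨ cong (λ d → suc ((m ∸ a) + d)) (sym (+-identityʳ _)) ⟩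
      2 * suc (m ∸ a) ∎

  length-C : length C ≡ 2 * (n 1 ∸ n S)
  length-C = begin
      length C
    ≡⟨ length-concatMap levelEdges g (range 2 S) (λ t∈ → length-levelEdges (∈-range⁻ 2 S t∈)) ⟩
      sum (map g (range 2 S))
    ≡⟨ sym (m+n∸n≡m _ (2 * n S)) ⟩
      sum (map g (range 2 S)) + 2 * n S ∸ 2 * n S
    ≡⟨ cong (_∸ 2 * n S) (telescope (λ t → 2 * n t) g s′ step) ⟩
      2 * n 1 ∸ 2 * n S
    ≡⟨ sym (*-distribˡ-∸ 2 (n 1) (n S)) ⟩
      2 * (n 1 ∸ n S) ∎
    where
    open ≡-Reasoning
    g : ℕ → ℕ
    g t = 2 * (n (t ∸ 1) ∸ n t)
    step : ∀ t → 2 ≤ t → t ≤ S → g t + 2 * n t ≡ 2 * n (t ∸ 1)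
    step t 2≤t t≤S = trans (sym (*-distribˡ-+ 2 (n (t ∸ 1) ∸ n t) (n t)))
                           (cong (2 *_) (m∸n+n≡m (<⇒≤ (n-level (2≤t , t≤S)))))

  distinct-levelEdges : ∀ {t} → Level t → AllPairs DistinctAsSets (levelEdges t)
  distinct-levelEdges {t} level@(2≤t , t≤S) =
    AllPairs.++⁺ uvv-distinct (AllPairs.++⁺ vuu-distinct (All.[] AllPairs.∷ AllPairs.[]) vuu-base) uvv-rest
    where
    top : ℕ
    top = n (t ∸ 1) ∸ 1

    2≤j : ∀ {j} → n t ≤ j → 2 ≤ j
    2≤j = ≤-trans (2≤n-level level)

    uvv-distinct : AllPairs DistinctAsSets (uvvEdges t)
    uvv-distinct = AllPairs.map⁺ (allPairs-range (suc (n t)) top λ {j} {j′} _ j<j′ _ →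
      distinctʳ (there (here refl))
        (∉-triple (v≢u t≤S t≤S) (v≢v 2≤t (≢-sym (<⇒≢ j<j′))) (v≢v 2≤t (≢-sym (<⇒≢ (≤-<-trans (m∸n≤m j 1) j<j′))))))

    vuu-distinct : AllPairs DistinctAsSets (vuuEdges t)
    vuu-distinct = AllPairs.map⁺ (allPairs-range (n t) top λ _ j<j′ _ →
      distinctʳ (here refl) (∉-triple (v≢v 2≤t (≢-sym (<⇒≢ j<j′))) (v≢u t≤S t≤S) (v≢u t≤S t≤S)))

    vuu-distinct-base : ∀ {j} → n t ≤ j → DistinctAsSets (vuu t j) (base t)
    vuu-distinct-base lo = distinctʳ (there (there (here refl)))
      (∉-triple (≢-sym (v≢diag1 2≤t (2≤j lo))) (≢-sym (u≢diag1 t≤S)) (≢-sym (u≢diag1 t≤S)))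

    uvv-distinct-rest : ∀ {j e′} → n t < j → e′ ∈ vuuEdges t ++ base t ∷ [] → DistinctAsSets (uvv t j) e′
    uvv-distinct-rest {j} n<j e′∈ with ∈-++⁻ (vuuEdges t) e′∈
    ... | inj₂ (here refl) =
      distinctˡ (there (here refl)) (∉-triple (v≢u t≤S t≤S) (v≢v 2≤t (≢-sym (<⇒≢ n<j))) (v≢diag1 2≤t (2≤j (<⇒≤ n<j))))
    ... | inj₁ e′∈vuu with ∈-map⁻ (vuu t) e′∈vuu
    ...   | j′ , _ , refl with j ≟ j′
    ...     | yes refl = distinctˡ (there (there (here refl)))
                           (∉-triple (v≢v 2≤t (<⇒≢ (m∸1<m (≤-trans (s≤s z≤n) n<j)))) (v≢u t≤S t≤S) (v≢u t≤S t≤S))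
    ...     | no j≢j′ = distinctˡ (there (here refl)) (∉-triple (v≢v 2≤t j≢j′) (v≢u t≤S t≤S) (v≢u t≤S t≤S))

    vuu-base : All (λ e → All (DistinctAsSets e) (base t ∷ [])) (vuuEdges t)
    vuu-base = All.map⁺ (All.tabulate λ j∈ → vuu-distinct-base (proj₁ (∈-range⁻ (n t) top j∈)) All.∷ All.[])

    uvv-rest : All (λ e → All (DistinctAsSets e) (vuuEdges t ++ base t ∷ [])) (uvvEdges t)
    uvv-rest = All.map⁺ (All.tabulate λ j∈ → All.tabulate (uvv-distinct-rest (proj₁ (∈-range⁻ (suc (n t)) top j∈))))

  data LevelVertex (t : ℕ) : Vec ℕ S → Set where
    u-vertex : ∀ {j} → LevelVertex t (u t j)
    v-vertex : ∀ {j} → 2 ≤ j → LevelVertex t (v t j)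
    diag-vertex : LevelVertex t (diag 1)

  edge-vertex : ∀ {t e z} → EdgeOf t e → z ∈ e → LevelVertex t z
  edge-vertex (uvv-edge _ _) (here refl) = u-vertex
  edge-vertex (uvv-edge slot _) (there (here refl)) = v-vertex (2≤slot slot)
  edge-vertex (uvv-edge (level , _) n<j) (there (there (here refl))) = v-vertex (≤-trans (2≤n-level level) (<⇒≤∸1 n<j))
  edge-vertex (vuu-edge slot) (here refl) = v-vertex (2≤slot slot)
  edge-vertex (vuu-edge _) (there (here refl)) = u-vertex
  edge-vertex (vuu-edge _) (there (there (here refl))) = u-vertex
  edge-vertex (base-edge _) (here refl) = u-vertex
  edge-vertex (base-edge level) (there (here refl)) = v-vertex (2≤n-level level)
  edge-vertex (base-edge _) (there (there (here refl))) = diag-vertex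

  v∈edge : ∀ {t e} → EdgeOf t e → ∃ λ j → 2 ≤ j × v t j ∈ e
  v∈edge (uvv-edge slot _) = _ , 2≤slot slot , there (here refl)
  v∈edge (vuu-edge slot) = _ , 2≤slot slot , here refl
  v∈edge (base-edge level) = _ , 2≤n-level level , there (here refl)

  v≢higher-level : ∀ {t t′ j z} → 2 ≤ t → t < t′ → t′ ≤ S → 2 ≤ j → LevelVertex t′ z → v t j ≢ z
  v≢higher-level 2≤t t<t′ t′≤S _ u-vertex = v≢u (<⇒≤ (<-≤-trans t<t′ t′≤S)) t′≤S
  v≢higher-level 2≤t t<t′ t′≤S _ (v-vertex 2≤j′) = v≢v-level 2≤t t<t′ t′≤S 2≤j′
  v≢higher-level 2≤t _ _ 2≤j diag-vertex = v≢diag1 2≤t 2≤j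

  distinct-levels : ∀ {t t′ e e′} → 2 ≤ t → t < t′ → t′ ≤ S → EdgeOf t e → EdgeOf t′ e′ → DistinctAsSets e e′
  distinct-levels 2≤t t<t′ t′≤S edge edge′ with v∈edge edge
  ... | j , 2≤j , v∈e = distinctˡ v∈e (λ v∈e′ → v≢higher-level 2≤t t<t′ t′≤S 2≤j (edge-vertex edge′ v∈e′) refl)

  distinct-C : AllPairs DistinctAsSets C
  distinct-C = AllPairs.concat⁺
    (All.map⁺ (All.tabulate λ t∈ → distinct-levelEdges (∈-range⁻ 2 S t∈)))
    (AllPairs.map⁺ (allPairs-range 2 S λ 2≤t t<t′ t′≤S → All.tabulate λ e∈ → All.tabulate λ e′∈ →
      distinct-levels 2≤t t<t′ t′≤S (levelEdges-view (2≤t , <⇒≤ (<-≤-trans t<t′ t′≤S)) e∈)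
                                    (levelEdges-view (≤-trans 2≤t (<⇒≤ t<t′) , t′≤S) e′∈)))

theorem3p4 : (s : ℕ) (n : ℕ → ℕ) → 1 ≤ s
    → (∀ i → 1 ≤ i → i < s → n (suc i) < n i)
    → 2 ≤ n s
    → (length (Cstar s n) ≡ 2 * (n 1 ∸ n s))
      × AllPairs DistinctAsSets (Cstar s n)
      × OneRealization (Hstar s n) (λ k → ∃[ i ] (1 ≤ i × i ≤ s × n i ≡ k))
theorem3p4 zero _ () _ _
theorem3p4 (suc s′) n _ dec 2≤n[s] = length-C , distinct-C , oneRealization
  where open Realization s′ n dec 2≤n[s]
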